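{- Let $k\geq 2$ and $b$ be integers with $k^2<b<(k+1)^2$. Then all digits in the non-terminating base-$b$ expansion of $1/k$ are at least $k$.
   Context: The non-terminating base-$b$ expansion of a number is the expansion that does not end in an infinite string of zeros. -}

module Defs where

open import Data.Nat as ℕ using (ℕ; zero; suc; _^_; NonZero)
open import Data.Nat.Properties using (m^n≢0)
open import Data.Integer using (+_)
open import Data.Rational using (ℚ; _/_; _+_; _-_; _<_; ∣_∣; 0ℚ)
open import Data.Product using (_×_; ∃-syntax)
open import Relation.Binary.PropositionalEquality using (_≢_)

-- A digit sequence d represents the fractional expansion 0.d₀d₁d₂… in base b,
-- i.e. d i is the coefficient of b^-(i+1).

digitTerm : (b : ℕ) .{{_ : NonZero b}} → (ℕ → ℕ) → ℕ → ℚ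
digitTerm b d i = _/_ (+ d i) (b ^ suc i) {{m^n≢0 b (suc i)}}

partialSum : (b : ℕ) .{{_ : NonZero b}} → (ℕ → ℕ) → ℕ → ℚ
partialSum b d zero    = 0ℚ
partialSum b d (suc n) = partialSum b d n + digitTerm b d n

ConvergesTo : (ℕ → ℚ) → ℚ → Set
ConvergesTo s x = ∀ ε → 0ℚ < ε → ∃[ N ] (∀ n → N ℕ.≤ n → ∣ s n - x ∣ < ε)

IsExpansion : (b : ℕ) .{{_ : NonZero b}} → (ℕ → ℕ) → ℚ → Set
IsExpansion b d x = (∀ i → d i ℕ.< b) × ConvergesTo (partialSum b d) x

NonTerminating : (ℕ → ℕ) → Set
NonTerminating d = ∀ N → ∃[ n ] (N ℕ.≤ n × d n ≢ 0)

IsNonTerminatingExpansion : (b : ℕ) .{{_ : NonZero b}} → (ℕ → ℕ) → ℚ → Set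
IsNonTerminatingExpansion b d x = IsExpansion b d x × NonTerminating d

module Submission where

-- Let A n be the number with base-b digits d₀ … dₙ₋₁, so the n-th partial sum is A n / bⁿ.
-- The partial sums increase to 1/k and, the expansion being non-terminating, never reach it,
-- so A n / bⁿ < 1/k; the digits being below b, the tail after n digits is at most 1/bⁿ, so
-- 1/k ≤ (A n + 1) / bⁿ. Hence A n · k < bⁿ ≤ (A n + 1) · k for every n. Using the left
-- inequality at n and the right one at n + 1, where A (n + 1) = b · A n + dₙ, gives
-- b ≤ (dₙ + 1) · k, and k² < b then forces dₙ ≥ k.

open import Defs
open import Data.Nat using (ℕ; suc; _*_; _≤_; _<_; NonZero)
open import Data.Integer using (+_)
open import Data.Rational using (_/_)

open import Data.Nat as ℕ using (zero; pred; _+_; _^_)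
import Data.Nat.Properties as ℕ
import Data.Integer as ℤ
import Data.Integer.Properties as ℤ
open import Data.Rational as ℚ using (ℚ; 0ℚ; _-_; ∣_∣)
import Data.Rational.Properties as ℚ
open import Data.Rational.Unnormalised as ℚᵘ using (mkℚᵘ)
import Data.Rational.Unnormalised.Properties as ℚᵘ
open import Data.Product using (_,_; _×_; ∃-syntax)
open import Data.Empty using (⊥)
open import Relation.Binary.PropositionalEquality
open import Algebra.Properties.Group ℚ.+-0-group using (⁻¹-anti-homo-//)
import Data.Nat.Tactic.RingSolver as ℕ-Ring
open import Algebra.Properties.CommutativeSemigroup ℕ.*-commutativeSemigroup using (x∙yz≈y∙xz)

toℚᵘ-/ : ∀ a n .{{_ : NonZero n}} → ℚ.toℚᵘ (+ a / n) ℚᵘ.≃ mkℚᵘ (+ a) (pred n)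
toℚᵘ-/ a (suc n) = ℚ.toℚᵘ-fromℚᵘ (mkℚᵘ (+ a) n)

/≤/⇒*≤* : ∀ a m c n .{{_ : NonZero m}} .{{_ : NonZero n}} →
          + a / m ℚ.≤ + c / n → a * n ≤ c * m
/≤/⇒*≤* a m@(suc _) c n@(suc _) p
  with ℚᵘ.*≤* q ← ℚᵘ.≤-respʳ-≃ (toℚᵘ-/ c n) (ℚᵘ.≤-respˡ-≃ (toℚᵘ-/ a m) (ℚ.toℚᵘ-mono-≤ p))
  = ℤ.drop‿+≤+ (subst₂ ℤ._≤_ (sym (ℤ.pos-* a n)) (sym (ℤ.pos-* c m)) q)

/</⇒*<* : ∀ a m c n .{{_ : NonZero m}} .{{_ : NonZero n}} →
          + a / m ℚ.< + c / n → a * n < c * m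
/</⇒*<* a m@(suc _) c n@(suc _) p
  with ℚᵘ.*<* q ← ℚᵘ.<-respʳ-≃ (toℚᵘ-/ c n) (ℚᵘ.<-respˡ-≃ (toℚᵘ-/ a m) (ℚ.toℚᵘ-mono-< p))
  = ℤ.drop‿+<+ (subst₂ ℤ._<_ (sym (ℤ.pos-* a n)) (sym (ℤ.pos-* c m)) q)

*≤*⇒/≤/ : ∀ a m c n .{{_ : NonZero m}} .{{_ : NonZero n}} →
          a * n ≤ c * m → + a / m ℚ.≤ + c / n
*≤*⇒/≤/ a m@(suc _) c n@(suc _) p = ℚ.toℚᵘ-cancel-≤
  (ℚᵘ.≤-respʳ-≃ (ℚᵘ.≃-sym (toℚᵘ-/ c n)) (ℚᵘ.≤-respˡ-≃ (ℚᵘ.≃-sym (toℚᵘ-/ a m))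
    (ℚᵘ.*≤* (subst₂ ℤ._≤_ (ℤ.pos-* a n) (ℤ.pos-* c m) (ℤ.+≤+ p)))))

private
  fraction-sum-numerators : ∀ a c b M N → N ≡ b * M →
    (+ a ℤ.* + N ℤ.+ + c ℤ.* + M) ℤ.* + N ≡ + (b * a + c) ℤ.* + (M * N)
  fraction-sum-numerators a c b M N refl = begin
    (+ a ℤ.* + N ℤ.+ + c ℤ.* + M) ℤ.* + N  ≡⟨ cong (ℤ._* + N) (cong₂ ℤ._+_ (ℤ.pos-* a N) (ℤ.pos-* c M)) ⟨
    (+ (a * N) ℤ.+ + (c * M)) ℤ.* + N      ≡⟨ cong (ℤ._* + N) (ℤ.pos-+ (a * N) (c * M)) ⟨
    + (a * N + c * M) ℤ.* + N              ≡⟨ ℤ.pos-* (a * N + c * M) N ⟨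
    + ((a * N + c * M) * N)                ≡⟨ cong +_ (identity a c b M) ⟩
    + ((b * a + c) * (M * N))              ≡⟨ ℤ.pos-* (b * a + c) (M * N) ⟩
    + (b * a + c) ℤ.* + (M * N)            ∎
    where
    open ≡-Reasoning
    identity : ∀ a c b M → (a * (b * M) + c * M) * (b * M) ≡ (b * a + c) * (M * (b * M))
    identity = ℕ-Ring.solve-∀

a/m+c/bm≡[ba+c]/bm : ∀ a c b m .{{_ : NonZero m}} .{{_ : NonZero (b * m)}} →
                     + a / m ℚ.+ + c / (b * m) ≡ + (b * a + c) / (b * m)
a/m+c/bm≡[ba+c]/bm a c b m@(suc m-1) = ℚ.toℚᵘ-injective (begin
  ℚ.toℚᵘ (+ a / m ℚ.+ + c / (b * m))
    ≈⟨ ℚ.toℚᵘ-homo-+ (+ a / m) (+ c / (b * m)) ⟩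
  ℚ.toℚᵘ (+ a / m) ℚᵘ.+ ℚ.toℚᵘ (+ c / (b * m))
    ≈⟨ ℚᵘ.+-cong (toℚᵘ-/ a m) (toℚᵘ-/ c (b * m)) ⟩
  mkℚᵘ (+ a) m-1 ℚᵘ.+ mkℚᵘ (+ c) (pred (b * m))
    ≈⟨ ℚᵘ.*≡* (fraction-sum-numerators a c b m _ (ℕ.suc-pred (b * m))) ⟩
  mkℚᵘ (+ (b * a + c)) (pred (b * m))
    ≈⟨ toℚᵘ-/ (b * a + c) (b * m) ⟨
  ℚ.toℚᵘ (+ (b * a + c) / (b * m))
    ∎)
  where open ℚᵘ.≃-Reasoning

ascending⇒monotone : (s : ℕ → ℚ) → (∀ n → s n ℚ.≤ s (suc n)) →
                     ∀ {m n} → m ≤ n → s m ℚ.≤ s n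
ascending⇒monotone s s-step {m} m≤n = go (ℕ.≤⇒≤′ m≤n)
  where
  go : ∀ {n} → m ℕ.≤′ n → s m ℚ.≤ s n
  go ℕ.≤′-refl      = ℚ.≤-refl
  go (ℕ.≤′-step m≤n) = ℚ.≤-trans (go m≤n) (s-step _)

p<q⇒0<q-p : ∀ {p q} → p ℚ.< q → 0ℚ ℚ.< q - p
p<q⇒0<q-p {p} {q} p<q = subst (ℚ._< q - p) (ℚ.+-inverseʳ p) (ℚ.+-monoˡ-< (ℚ.- p) p<q)

∣p-q∣≡∣q-p∣ : ∀ p q → ∣ p - q ∣ ≡ ∣ q - p ∣
∣p-q∣≡∣q-p∣ p q = trans (sym (ℚ.∣-p∣≡∣p∣ (p - q))) (cong ∣_∣ (⁻¹-anti-homo-// p q))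

positive-gap-absurd : ∀ {p ε} → 0ℚ ℚ.< ε → ε ℚ.≤ p → ∣ p ∣ ℚ.< ε → ⊥
positive-gap-absurd {p} {ε} 0<ε ε≤p ∣p∣<ε = ℚ.<-irrefl refl (ℚ.<-≤-trans p<ε ε≤p)
  where
  p<ε : p ℚ.< ε
  p<ε = subst (ℚ._< ε) (ℚ.0≤p⇒∣p∣≡p (ℚ.≤-trans (ℚ.<⇒≤ 0<ε) ε≤p)) ∣p∣<ε

module _ {s : ℕ → ℚ} {x : ℚ} (s→x : ConvergesTo s x) where

  close-to-limit : ∀ {ε} → 0ℚ ℚ.< ε → ∀ N → ∃[ n ] (N ≤ n × ∣ s n - x ∣ ℚ.< ε)
  close-to-limit 0<ε N with s→x _ 0<ε
  ... | M , close = N ℕ.⊔ M , ℕ.m≤m⊔n N M , close (N ℕ.⊔ M) (ℕ.m≤n⊔m N M)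

  lowerBound⇒≤-limit : ∀ {c} N → (∀ n → N ≤ n → c ℚ.≤ s n) → c ℚ.≤ x
  lowerBound⇒≤-limit {c} N c≤s = ℚ.≮⇒≥ λ x<c →
    let n , N≤n , close = close-to-limit (p<q⇒0<q-p x<c) N
    in positive-gap-absurd (p<q⇒0<q-p x<c) (ℚ.+-monoˡ-≤ (ℚ.- x) (c≤s n N≤n)) close

  upperBound⇒limit-≤ : ∀ {c} N → (∀ n → N ≤ n → s n ℚ.≤ c) → x ℚ.≤ c
  upperBound⇒limit-≤ {c} N s≤c = ℚ.≮⇒≥ λ c<x →
    let n , N≤n , close = close-to-limit (p<q⇒0<q-p c<x) N
    in positive-gap-absurd (p<q⇒0<q-p c<x) (ℚ.+-monoʳ-≤ x (ℚ.neg-antimono-≤ (s≤c n N≤n)))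
         (subst (ℚ._< x - c) (∣p-q∣≡∣q-p∣ (s n) x) close)

p≤p+q : ∀ p {q} → 0ℚ ℚ.≤ q → p ℚ.≤ p ℚ.+ q
p≤p+q p 0≤q = subst (ℚ._≤ p ℚ.+ _) (ℚ.+-identityʳ p) (ℚ.+-monoʳ-≤ p 0≤q)

p<p+q : ∀ p {q} → 0ℚ ℚ.< q → p ℚ.< p ℚ.+ q
p<p+q p 0<q = subst (ℚ._< p ℚ.+ _) (ℚ.+-identityʳ p) (ℚ.+-monoʳ-< p 0<q)

module Expansion (b : ℕ) .{{_ : NonZero b}} (d : ℕ → ℕ) where

  infix 7 _/b^_
  _/b^_ : ℕ → ℕ → ℚ
  a /b^ n = _/_ (+ a) (b ^ n) {{ℕ.m^n≢0 b n}}

  prefixNumeral : ℕ → ℕ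
  prefixNumeral zero    = 0
  prefixNumeral (suc n) = b * prefixNumeral n + d n

  partialSum≡prefixNumeral/b^n : ∀ n → partialSum b d n ≡ prefixNumeral n /b^ n
  partialSum≡prefixNumeral/b^n zero    = refl
  partialSum≡prefixNumeral/b^n (suc n) = begin
    partialSum b d n ℚ.+ digitTerm b d n    ≡⟨ cong (ℚ._+ digitTerm b d n) (partialSum≡prefixNumeral/b^n n) ⟩
    prefixNumeral n /b^ n ℚ.+ d n /b^ suc n  ≡⟨ a/m+c/bm≡[ba+c]/bm (prefixNumeral n) (d n) b (b ^ n)
                                                  {{ℕ.m^n≢0 b n}} {{ℕ.m^n≢0 b (suc n)}} ⟩
    prefixNumeral (suc n) /b^ suc n          ∎
    where open ≡-Reasoning

  partialSum-ascending : ∀ n → partialSum b d n ℚ.≤ partialSum b d (suc n)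
  partialSum-ascending n =
    p≤p+q (partialSum b d n)
      (ℚ.nonNegative⁻¹ _ {{ℚ.normalize-nonNeg (d n) (b ^ suc n) {{ℕ.m^n≢0 b (suc n)}}}})

  partialSum-strict : ∀ n → d n ≢ 0 → partialSum b d n ℚ.< partialSum b d (suc n)
  partialSum-strict n dₙ≢0 = p<p+q (partialSum b d n)
    (ℚ.positive⁻¹ _ {{ℚ.normalize-pos (d n) (b ^ suc n) {{ℕ.m^n≢0 b (suc n)}} {{ℕ.≢-nonZero dₙ≢0}}}})

  partialSum-mono : ∀ {m n} → m ≤ n → partialSum b d m ℚ.≤ partialSum b d n
  partialSum-mono = ascending⇒monotone (partialSum b d) partialSum-ascending

  module _ (d<b : ∀ i → d i < b) where

    prefixNumeral-+-< : ∀ n j → prefixNumeral (n + j) < suc (prefixNumeral n) * b ^ j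
    prefixNumeral-+-< n zero
      rewrite ℕ.+-identityʳ n | ℕ.*-identityʳ (suc (prefixNumeral n)) = ℕ.n<1+n (prefixNumeral n)
    prefixNumeral-+-< n (suc j) rewrite ℕ.+-suc n j = begin-strict
      b * A + d (n + j)                   <⟨ ℕ.+-monoʳ-< (b * A) (d<b (n + j)) ⟩
      b * A + b                           ≡⟨ trans (ℕ.+-comm (b * A) b) (sym (ℕ.*-suc b A)) ⟩
      b * suc A                           ≤⟨ ℕ.*-monoʳ-≤ b (prefixNumeral-+-< n j) ⟩
      b * (suc (prefixNumeral n) * b ^ j) ≡⟨ x∙yz≈y∙xz b (suc (prefixNumeral n)) (b ^ j) ⟩
      suc (prefixNumeral n) * b ^ suc j   ∎
      where
      open ℕ.≤-Reasoning
      A = prefixNumeral (n + j)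

    partialSum≤[prefixNumeral+1]/b^n : ∀ {n m} → n ≤ m →
                                       partialSum b d m ℚ.≤ suc (prefixNumeral n) /b^ n
    partialSum≤[prefixNumeral+1]/b^n {n} n≤m with j , refl ← ℕ.m≤n⇒∃[o]m+o≡n n≤m =
      subst (ℚ._≤ _) (sym (partialSum≡prefixNumeral/b^n (n + j)))
        (*≤*⇒/≤/ (prefixNumeral (n + j)) (b ^ (n + j)) (suc (prefixNumeral n)) (b ^ n)
                 {{ℕ.m^n≢0 b (n + j)}} {{ℕ.m^n≢0 b n}} (begin
          prefixNumeral (n + j) * b ^ n          ≤⟨ ℕ.*-monoˡ-≤ (b ^ n) (ℕ.<⇒≤ (prefixNumeral-+-< n j)) ⟩
          suc (prefixNumeral n) * b ^ j * b ^ n  ≡⟨ ℕ.*-assoc (suc (prefixNumeral n)) (b ^ j) (b ^ n) ⟩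
          suc (prefixNumeral n) * (b ^ j * b ^ n) ≡⟨ cong (suc (prefixNumeral n) *_) b^j*b^n≡b^[n+j] ⟩
          suc (prefixNumeral n) * b ^ (n + j)    ∎))
      where
      open ℕ.≤-Reasoning
      b^j*b^n≡b^[n+j] : b ^ j * b ^ n ≡ b ^ (n + j)
      b^j*b^n≡b^[n+j] = trans (ℕ.*-comm (b ^ j) (b ^ n)) (sym (ℕ.^-distribˡ-+-* b n j))

  module _ {x : ℚ} (S→x : ConvergesTo (partialSum b d) x) where

    prefixNumeral/b^n<value : NonTerminating d → ∀ n → prefixNumeral n /b^ n ℚ.< x
    prefixNumeral/b^n<value nonTerminating n with m , n≤m , dₘ≢0 ← nonTerminating n = begin-strict
      prefixNumeral n /b^ n     ≡⟨ partialSum≡prefixNumeral/b^n n ⟨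
      partialSum b d n         ≤⟨ partialSum-mono n≤m ⟩
      partialSum b d m         <⟨ partialSum-strict m dₘ≢0 ⟩
      partialSum b d (suc m)   ≤⟨ lowerBound⇒≤-limit S→x (suc m) (λ _ → partialSum-mono) ⟩
      x                        ∎
      where open ℚ.≤-Reasoning

    value≤[prefixNumeral+1]/b^n : (∀ i → d i < b) → ∀ n → x ℚ.≤ suc (prefixNumeral n) /b^ n
    value≤[prefixNumeral+1]/b^n d<b n =
      upperBound⇒limit-≤ S→x n (λ _ → partialSum≤[prefixNumeral+1]/b^n d<b)

b≤[c+1]*k : ∀ {a b c k B} → a * k < B → b * B ≤ suc (b * a + c) * k → b ≤ suc c * k
b≤[c+1]*k {a} {b} {c} {k} {B} ak<B bB≤[ba+c+1]k = ℕ.+-cancelˡ-≤ (b * (a * k)) b (suc c * k) (begin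
  b * (a * k) + b          ≡⟨ trans (ℕ.+-comm (b * (a * k)) b) (sym (ℕ.*-suc b (a * k))) ⟩
  b * suc (a * k)          ≤⟨ ℕ.*-monoʳ-≤ b ak<B ⟩
  b * B                    ≤⟨ bB≤[ba+c+1]k ⟩
  suc (b * a + c) * k      ≡⟨ expand b a c k ⟩
  b * (a * k) + suc c * k  ∎)
  where
  open ℕ.≤-Reasoning
  expand : ∀ b a c k → suc (b * a + c) * k ≡ b * (a * k) + suc c * k
  expand = ℕ-Ring.solve-∀

b≤[digit+1]*k : ∀ k b .{{_ : NonZero k}} .{{_ : NonZero b}} (d : ℕ → ℕ) →
                IsNonTerminatingExpansion b d (+ 1 / k) → ∀ n → b ≤ suc (d n) * k
b≤[digit+1]*k k b {{k≢0}} d ((d<b , S→1/k) , nonTerminating) n =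
  b≤[c+1]*k (numerator-below n) (numerator+1-above (suc n))
  where
  open Expansion b d
  numerator-below : ∀ n → prefixNumeral n * k < b ^ n
  numerator-below n = subst (prefixNumeral n * k <_) (ℕ.*-identityˡ (b ^ n))
    (/</⇒*<* (prefixNumeral n) (b ^ n) 1 k {{ℕ.m^n≢0 b n}}
             (prefixNumeral/b^n<value S→1/k nonTerminating n))
  numerator+1-above : ∀ n → b ^ n ≤ suc (prefixNumeral n) * k
  numerator+1-above n = subst (_≤ suc (prefixNumeral n) * k) (ℕ.*-identityˡ (b ^ n))
    (/≤/⇒*≤* 1 k (suc (prefixNumeral n)) (b ^ n) {{k≢0}} {{ℕ.m^n≢0 b n}}
             (value≤[prefixNumeral+1]/b^n S→1/k d<b n))

lemma3p4 : (k b : ℕ) .{{_ : NonZero k}} .{{_ : NonZero b}} →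
    2 ≤ k → k * k < b → b < suc k * suc k →
    (d : ℕ → ℕ) → IsNonTerminatingExpansion b d ((+ 1) / k) →
    (i : ℕ) → k ≤ d i
lemma3p4 k b _ k*k<b _ d expansion i =
  ℕ.s≤s⁻¹ (ℕ.*-cancelʳ-< k k (suc (d i)) (ℕ.<-≤-trans k*k<b (b≤[digit+1]*k k b d expansion i)))
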